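{- Let $G$ be a graph with $n$ vertices. If $\kappa(M[IAS(G)])=n$, then the diameter of $G$ is at most $2$.
   Context: A graph is a finite looped simple graph; distances and diameter are with respect to non-loop edges. $A(G)$ is the $GF(2)$ adjacency matrix (diagonal 1 iff looped). $M[IAS(G)]$ is the binary matroid represented by $(I\;A(G)\;A(G)+I)$. For a matroid on $W$ with rank $r$, $\lambda(S)=r(S)+r(W-S)-r(M)$; $S$ is a vertical $k$-separation if $\lambda(S)<k$ and $r(S),r(W-S)\ge k$; $\kappa(M)=\min(\{k\mid\text{vertical }k\text{ -separation exists}\}\cup\{r(M)\})$. -}

module Defs where

open import Data.Nat using (ℕ; zero; suc; _+_; _≤_; _<_)
open import Data.Bool using (Bool; true; false; _∧_; _xor_; not)
open import Data.Fin using (Fin; splitAt)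
open import Data.Fin.Properties using () renaming (_≟_ to _≟ᶠ_)
open import Data.Fin.Subset using (Subset; _⊆_; ∣_∣; ∁; ⊤; Nonempty; _∈_)
open import Data.Vec using (lookup)
open import Data.Sum using (_⊎_; inj₁; inj₂)
open import Data.Product using (Σ; _×_; ∃; ∃-syntax; _,_)
open import Relation.Nullary using (¬_; does)
open import Relation.Binary.PropositionalEquality using (_≡_; _≢_)

-- Looped simple graphs on vertex set Fin n, given by their GF(2)
-- adjacency matrix (GF(2) = Bool with xor / ∧): symmetric, and
-- the diagonal entry is true iff the vertex is looped.

record Graph (n : ℕ) : Set where
  field
    adj : Fin n → Fin n → Bool
    sym : ∀ u v → adj u v ≡ adj v u
open Graph public

Edge : ∀ {n} → Graph n → Fin n → Fin n → Set
Edge G u v = (u ≢ v) × (adj G u v ≡ true)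

data Walk {n} (G : Graph n) : Fin n → Fin n → ℕ → Set where
  here : ∀ {u} → Walk G u u zero
  step : ∀ {u v w ℓ} → Edge G u v → Walk G v w ℓ → Walk G u w (suc ℓ)

-- diameter ≤ d : every two vertices are at distance ≤ d
-- (disconnected graphs have infinite diameter)
DiameterAtMost : ∀ {n} → Graph n → ℕ → Set
DiameterAtMost G d = ∀ u v → ∃[ ℓ ] (ℓ ≤ d × Walk G u v ℓ)

Matrix : ℕ → ℕ → Set
Matrix r m = Fin r → Fin m → Bool

δ : ∀ {n} → Fin n → Fin n → Bool
δ i j = does (i ≟ᶠ j)

xorSum : ∀ {m} → (Fin m → Bool) → Bool
xorSum {zero}  f = false
xorSum {suc m} f = f Fin.zero xor xorSum (λ j → f (Fin.suc j))

colSum : ∀ {r m} → Matrix r m → Subset m → Fin r → Bool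
colSum M U i = xorSum (λ j → lookup U j ∧ M i j)

Independent : ∀ {r m} → Matrix r m → Subset m → Set
Independent M T = ∀ U → U ⊆ T → Nonempty U → ¬ (∀ i → colSum M U i ≡ false)

IsRank : ∀ {r m} → Matrix r m → Subset m → ℕ → Set
IsRank M S k =
  (Σ (Subset _) λ T → T ⊆ S × Independent M T × ∣ T ∣ ≡ k) ×
  (∀ T → T ⊆ S → Independent M T → ∣ T ∣ ≤ k)

-- vertical k-separation: λ(S) = r(S) + r(W-S) - r(M) < k,
-- r(S) ≥ k, r(W-S) ≥ k.  (λ(S) < k is written a + b < k + c,
-- equivalent since a + b ≥ c.)
VerticalSep : ∀ {r m} → Matrix r m → ℕ → Subset m → Set
VerticalSep M k S = ∃[ a ] ∃[ b ] ∃[ c ]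
  (IsRank M S a × IsRank M (∁ S) b × IsRank M ⊤ c ×
   a + b < k + c × k ≤ a × k ≤ b)

HasVerticalSep : ∀ {r m} → Matrix r m → ℕ → Set
HasVerticalSep M k = ∃[ S ] VerticalSep M k S

-- κ(M) = min({k | vertical k-separation exists} ∪ {r(M)})
KappaCandidate : ∀ {r m} → Matrix r m → ℕ → Set
KappaCandidate M k = HasVerticalSep M k ⊎ IsRank M ⊤ k

IsKappa : ∀ {r m} → Matrix r m → ℕ → Set
IsKappa M k = KappaCandidate M k × (∀ j → KappaCandidate M j → k ≤ j)

-- The matrix (I  A(G)  A(G)+I), columns indexed by Fin (n + (n + n)).

IAS : ∀ {n} → Graph n → Matrix n (n + (n + n))
IAS {n} G i j with splitAt n j
... | inj₁ a = δ i a
... | inj₂ rest with splitAt n rest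
...   | inj₁ b = adj G i b
...   | inj₂ c = adj G i c xor δ i c

module Submission where

-- Suppose u, v are at distance at least 3 and let S be the set of
-- columns of (I A A+I) whose vertex lies in the closed neighbourhood N[u].
-- Column j of the matrix is supported on the closed neighbourhood of its
-- vertex, so every column in S is zero in row v (v is far from N[u]) and
-- every column outside S is zero in row u.  Hence r(S) ≤ n-1 and
-- r(W-S) ≤ n-1, while the identity columns give r(M) ≥ n.  A partition
-- whose two sides both have rank below r(M) is a vertical k-separation
-- for k = r(S) + r(W-S) + 1 - r(M) ≤ r(S) ≤ n-1, contradicting κ = n.

open import Defs
open import Algebra.Bundles using (CommutativeRing; CommutativeMonoid)
open import Data.Nat using (ℕ; zero; suc; _+_; _∸_; _≤_; _<_; z≤n; s≤s)
open import Data.Nat.Properties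
  using (≤-trans; ≤-pred; ≤∧≢⇒<; m≤n⇒m≤1+n; +-monoʳ-≤; +-suc; m≤n+o⇒m∸n≤o; m≤n+m∸n; +-comm; +-identityʳ; 1+n≰n; <-≤-trans)
  renaming (_≟_ to _≟ⁿ_)
open import Data.Bool using (Bool; true; false; _∧_; _∨_; _xor_; not)
open import Data.Bool.Properties
  using (xor-identityʳ; xor-same; ∨-identityʳ; not-injective; ∧-distribʳ-xor; ∧-conicalˡ; ∧-conicalʳ; ∨-conicalˡ; ∨-conicalʳ; ¬-not;
         xor-∧-commutativeRing)
  renaming (_≟_ to _≟ᵇ_)
open import Algebra.Properties.CommutativeSemigroup
  (CommutativeMonoid.commutativeSemigroup (CommutativeRing.+-commutativeMonoid xor-∧-commutativeRing))
  using (interchange)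
open import Data.Fin using (Fin; splitAt; join; punchIn; punchOut)
open import Data.Fin.Properties using (all?; any?; join-splitAt; punchIn-punchOut; suc-injective; 0≢1+n)
  renaming (_≟_ to _≟ᶠ_)
open import Data.Fin.Subset using (Subset; _⊆_; ∣_∣; ∁; ⊤; ⊥; _∈_)
open import Data.Fin.Subset.Properties
  using (anySubset?; nonempty?; _⊆?_; ∣p∣≤n; ∣⊥∣≡0; Empty-unique; ⊆⊤; ∉⊥)
open import Data.Vec using (_∷_; lookup; _[_]≔_; tabulate; _++_)
open import Data.Vec.Properties
  using ([]=⇒lookup; lookup⇒[]=; lookup∘update; lookup∘update′; lookup-replicate;
         lookup∘tabulate; lookup-map; lookup-splitAt)
open import Data.Sum using (_⊎_; inj₁; inj₂; [_,_]′)
open import Data.Product using (Σ; _×_; ∃-syntax; _,_; proj₁; proj₂)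
open import Data.Empty using (⊥-elim) renaming (⊥ to False)
open import Relation.Nullary using (¬_; Dec; yes; no; contradiction)
open import Relation.Nullary.Decidable using (dec-true; dec-false; _×-dec_; ¬?)
open import Relation.Binary.PropositionalEquality
  using (_≡_; _≢_; refl; trans; cong; cong₂; subst; module ≡-Reasoning)
  renaming (sym to ≡-sym)

xor-false⇒≡ : ∀ x y → x xor y ≡ false → x ≡ y
xor-false⇒≡ false false _ = refl
xor-false⇒≡ true  true  _ = refl

xorSum-cong : ∀ {m} {f g : Fin m → Bool} → (∀ j → f j ≡ g j) → xorSum f ≡ xorSum g
xorSum-cong {zero}  f≡g = refl
xorSum-cong {suc m} f≡g = cong₂ _xor_ (f≡g Fin.zero) (xorSum-cong (λ j → f≡g (Fin.suc j)))

xorSum-xor : ∀ {m} (f g : Fin m → Bool) →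
             xorSum (λ j → f j xor g j) ≡ xorSum f xor xorSum g
xorSum-xor {zero}  f g = refl
xorSum-xor {suc m} f g =
  trans (cong ((f Fin.zero xor g Fin.zero) xor_) (xorSum-xor (λ j → f (Fin.suc j)) (λ j → g (Fin.suc j))))
        (interchange (f Fin.zero) (g Fin.zero) _ _)

xorSum-∧ : ∀ {m} (f : Fin m → Bool) c → xorSum (λ j → f j ∧ c) ≡ xorSum f ∧ c
xorSum-∧ {zero}  f c = refl
xorSum-∧ {suc m} f c =
  trans (cong ((f Fin.zero ∧ c) xor_) (xorSum-∧ (λ j → f (Fin.suc j)) c))
        (≡-sym (∧-distribʳ-xor c (f Fin.zero) _))

xorSum-zero : ∀ {m} {f : Fin m → Bool} → (∀ j → f j ≡ false) → xorSum f ≡ false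
xorSum-zero {zero}  f≡0 = refl
xorSum-zero {suc m} f≡0 = cong₂ _xor_ (f≡0 Fin.zero) (xorSum-zero (λ j → f≡0 (Fin.suc j)))

xorSum-single : ∀ {m} (f : Fin m → Bool) (j₀ : Fin m) →
                (∀ j → f j ≡ true → j ≡ j₀) → xorSum f ≡ f j₀
xorSum-single {suc m} f Fin.zero only =
  trans (cong (f Fin.zero xor_) (xorSum-zero (λ j → ¬-not (λ fj → 0≢1+n (≡-sym (only (Fin.suc j) fj))))))
        (xor-identityʳ (f Fin.zero))
xorSum-single {suc m} f (Fin.suc j₀) only =
  trans (cong (_xor xorSum (λ j → f (Fin.suc j))) (¬-not (λ f0 → 0≢1+n (only Fin.zero f0))))
        (xorSum-single (λ j → f (Fin.suc j)) j₀ (λ j fj → suc-injective (only (Fin.suc j) fj)))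

lookup⇒∈ : ∀ {m} {U : Subset m} {j} → lookup U j ≡ true → j ∈ U
lookup⇒∈ {U = U} {j} = lookup⇒[]= j U

⊆-lookup : ∀ {m} {U T : Subset m} → U ⊆ T → ∀ {j} → lookup U j ≡ true → lookup T j ≡ true
⊆-lookup U⊆T Uj = []=⇒lookup (U⊆T (lookup⇒∈ Uj))

∣remove∣ : ∀ {m} (T : Subset m) {t} → lookup T t ≡ true → ∣ T ∣ ≡ suc ∣ T [ t ]≔ false ∣
∣remove∣ (true  ∷ T) {Fin.zero}  refl = refl
∣remove∣ (true  ∷ T) {Fin.suc t} Tt   = cong suc (∣remove∣ T Tt)
∣remove∣ (false ∷ T) {Fin.suc t} Tt   = ∣remove∣ T Tt

colSum-zeroRow : ∀ {r m} {M : Matrix r m} {U : Subset m} {i} →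
                 (∀ j → lookup U j ≡ true → M i j ≡ false) → colSum M U i ≡ false
colSum-zeroRow {M = M} {U} {i} vanish = xorSum-zero term
  where
  term : ∀ j → (lookup U j ∧ M i j) ≡ false
  term j with lookup U j in Uj
  ... | false = refl
  ... | true  = vanish j Uj

colSum-insert : ∀ {r m} {M : Matrix r m} {U : Subset m} {t} i →
                lookup U t ≡ false → colSum M (U [ t ]≔ true) i ≡ colSum M U i xor M i t
colSum-insert {M = M} {U} {t} i t∉U = begin
  colSum M (U [ t ]≔ true) i
    ≡⟨ xorSum-cong term ⟩
  xorSum (λ j → (lookup U j ∧ M i j) xor (δ j t ∧ M i t))
    ≡⟨ xorSum-xor (λ j → lookup U j ∧ M i j) (λ j → δ j t ∧ M i t) ⟩
  colSum M U i xor xorSum (λ j → δ j t ∧ M i t)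
    ≡⟨ cong (colSum M U i xor_) (xorSum-single (λ j → δ j t ∧ M i t) t onlyAtT) ⟩
  colSum M U i xor (δ t t ∧ M i t)
    ≡⟨ cong (λ d → colSum M U i xor (d ∧ M i t)) (dec-true (t ≟ᶠ t) refl) ⟩
  colSum M U i xor M i t ∎
  where
  open ≡-Reasoning
  term : ∀ j → (lookup (U [ t ]≔ true) j ∧ M i j) ≡ (lookup U j ∧ M i j) xor (δ j t ∧ M i t)
  term j with j ≟ᶠ t
  ... | yes refl rewrite lookup∘update t U true | t∉U = refl
  ... | no j≢t   rewrite lookup∘update′ j≢t U true = ≡-sym (xor-identityʳ _)
  onlyAtT : ∀ j → (δ j t ∧ M i t) ≡ true → j ≡ t
  onlyAtT j δ∧M with j ≟ᶠ t
  ... | yes j≡t = j≡t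
  onlyAtT j () | no _

colSum-uniqueSupport : ∀ {r m} {M : Matrix r m} {U : Subset m} {i j} →
  lookup U j ≡ true → M i j ≡ true →
  (∀ j′ → lookup U j′ ≡ true → M i j′ ≡ true → j′ ≡ j) → colSum M U i ≡ true
colSum-uniqueSupport {M = M} {U} {i} {j} Uj Mij unique =
  trans (xorSum-single (λ j′ → lookup U j′ ∧ M i j′) j only) (cong₂ _∧_ Uj Mij)
  where
  only : ∀ j′ → (lookup U j′ ∧ M i j′) ≡ true → j′ ≡ j
  only j′ U∧M = unique j′ (∧-conicalˡ _ _ U∧M) (∧-conicalʳ _ _ U∧M)

deleteRow : ∀ {r m} → Fin (suc r) → Matrix (suc r) m → Matrix r m
deleteRow v M k = M (punchIn v k)

deleteRow-independent : ∀ {r m} {M : Matrix (suc r) m} {T : Subset m} v →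
  (∀ j → lookup T j ≡ true → M v j ≡ false) →
  Independent M T → Independent (deleteRow v M) T
deleteRow-independent {M = M} v vanish ind U U⊆T nonempty sumsToZero =
  ind U U⊆T nonempty allRows
  where
  allRows : ∀ i → colSum M U i ≡ false
  allRows i with v ≟ᶠ i
  ... | yes refl = colSum-zeroRow {M = M} {U} (λ j Uj → vanish j (⊆-lookup U⊆T Uj))
  ... | no v≢i   = subst (λ i′ → colSum M U i′ ≡ false) (punchIn-punchOut v≢i)
                         (sumsToZero (punchOut v≢i))

-- clear the first row with pivot column t (M 0 t = 1): subtract
-- M k t times row 0 from each row k, then delete row 0
eliminate : ∀ {r m} → Fin m → Matrix (suc r) m → Matrix r m
eliminate t M k j = M (Fin.suc k) j xor (M Fin.zero j ∧ M (Fin.suc k) t)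

colSum-eliminate : ∀ {r m} (M : Matrix (suc r) m) U t k →
  colSum (eliminate t M) U k ≡ colSum M U (Fin.suc k) xor (colSum M U Fin.zero ∧ M (Fin.suc k) t)
colSum-eliminate M U t k = begin
  colSum (eliminate t M) U k
    ≡⟨ xorSum-cong term ⟩
  xorSum (λ j → (lookup U j ∧ M (Fin.suc k) j) xor ((lookup U j ∧ M Fin.zero j) ∧ M (Fin.suc k) t))
    ≡⟨ xorSum-xor (λ j → lookup U j ∧ M (Fin.suc k) j) (λ j → (lookup U j ∧ M Fin.zero j) ∧ M (Fin.suc k) t) ⟩
  colSum M U (Fin.suc k) xor xorSum (λ j → (lookup U j ∧ M Fin.zero j) ∧ M (Fin.suc k) t)
    ≡⟨ cong (colSum M U (Fin.suc k) xor_) (xorSum-∧ (λ j → lookup U j ∧ M Fin.zero j) _) ⟩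
  colSum M U (Fin.suc k) xor (colSum M U Fin.zero ∧ M (Fin.suc k) t) ∎
  where
  open ≡-Reasoning
  term : ∀ j → (lookup U j ∧ eliminate t M k j) ≡
               (lookup U j ∧ M (Fin.suc k) j) xor ((lookup U j ∧ M Fin.zero j) ∧ M (Fin.suc k) t)
  term j with lookup U j
  ... | true  = refl
  ... | false = refl

-- elimination keeps the remaining columns T - t independent: a dependency
-- among them is a dependency of U or of U + t in the original matrix
eliminate-independent : ∀ {r m} {M : Matrix (suc r) m} {T : Subset m} {t} →
  lookup T t ≡ true → M Fin.zero t ≡ true →
  Independent M T → Independent (eliminate t M) (T [ t ]≔ false)
eliminate-independent {M = M} {T} {t} Tt pivot ind U U⊆T-t nonempty sumsToZero =
  dependent (colSum M U Fin.zero) refl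
  where
  T-t⊆T : ∀ {j} → lookup (T [ t ]≔ false) j ≡ true → lookup T j ≡ true
  T-t⊆T {j} T-tj with j ≟ᶠ t
  ... | yes refl = Tt
  ... | no j≢t   = trans (≡-sym (lookup∘update′ j≢t T false)) T-tj
  U⊆T : U ⊆ T
  U⊆T j∈U = lookup⇒∈ (T-t⊆T ([]=⇒lookup (U⊆T-t j∈U)))
  t∉U : lookup U t ≡ false
  t∉U = ¬-not (λ Ut → contradiction (trans (≡-sym (lookup∘update t T false)) (⊆-lookup U⊆T-t Ut)) λ ())
  U+t⊆T : (U [ t ]≔ true) ⊆ T
  U+t⊆T {j} j∈U+t with j ≟ᶠ t
  ... | yes refl = lookup⇒∈ Tt
  ... | no j≢t   = U⊆T (lookup⇒∈ (trans (≡-sym (lookup∘update′ j≢t U true)) ([]=⇒lookup j∈U+t)))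
  below : ∀ k → colSum M U (Fin.suc k) ≡ colSum M U Fin.zero ∧ M (Fin.suc k) t
  below k = xor-false⇒≡ _ _ (trans (≡-sym (colSum-eliminate M U t k)) (sumsToZero k))
  dependent : ∀ s → colSum M U Fin.zero ≡ s → False
  dependent false row0 = ind U U⊆T nonempty λ
    { Fin.zero    → row0
    ; (Fin.suc k) → trans (below k) (cong (_∧ M (Fin.suc k) t) row0) }
  dependent true row0 = ind (U [ t ]≔ true) U+t⊆T (t , lookup⇒∈ (lookup∘update t U true)) λ
    { Fin.zero    → trans (colSum-insert {M = M} {U} Fin.zero t∉U) (cong₂ _xor_ row0 pivot)
    ; (Fin.suc k) → trans (colSum-insert {M = M} {U} (Fin.suc k) t∉U)
                          (trans (cong (_xor M (Fin.suc k) t) (trans (below k) (cong (_∧ M (Fin.suc k) t) row0)))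
                                 (xor-same (M (Fin.suc k) t))) }

-- an independent set of columns has at most as many elements as there are
-- rows: use a pivot in row 0 if T has one, otherwise row 0 is zero on T
independent-card≤rows : ∀ {r m} (M : Matrix r m) (T : Subset m) → Independent M T → ∣ T ∣ ≤ r
independent-card≤rows {zero} {m} M T ind with nonempty? T
... | yes nonempty = ⊥-elim (ind T (λ j∈T → j∈T) nonempty λ ())
... | no empty     = subst (_≤ 0) (trans (≡-sym (∣⊥∣≡0 m)) (cong ∣_∣ (≡-sym (Empty-unique empty)))) z≤n
independent-card≤rows {suc r} M T ind
  with any? (λ j → (lookup T j ≟ᵇ true) ×-dec (M Fin.zero j ≟ᵇ true))
... | yes (t , Tt , pivot) =
  subst (_≤ suc r) (≡-sym (∣remove∣ T Tt))
        (s≤s (independent-card≤rows (eliminate t M) _ (eliminate-independent Tt pivot ind)))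
... | no noPivot =
  m≤n⇒m≤1+n (independent-card≤rows (deleteRow Fin.zero M) T
               (deleteRow-independent Fin.zero (λ j Tj → ¬-not (λ M0j → noPivot (j , Tj , M0j))) ind))

independent? : ∀ {r m} (M : Matrix r m) (T : Subset m) → Dec (Independent M T)
independent? M T
  with anySubset? (λ U → (U ⊆? T) ×-dec (nonempty? U ×-dec all? (λ i → colSum M U i ≟ᵇ false)))
... | yes (U , U⊆T , nonempty , sumsToZero) = no (λ ind → ind U U⊆T nonempty sumsToZero)
... | no noDependency = yes (λ U U⊆T nonempty sumsToZero → noDependency (U , U⊆T , nonempty , sumsToZero))

-- every set of columns has a rank: the largest size of an independent
-- subset, found by searching downwards from the trivial bound m
module _ {r m} (M : Matrix r m) (S : Subset m) where

  IndependentOfSize : ℕ → Set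
  IndependentOfSize k = Σ (Subset m) λ T → T ⊆ S × Independent M T × ∣ T ∣ ≡ k

  independentOfSize? : ∀ k → Dec (IndependentOfSize k)
  independentOfSize? k = anySubset? (λ T → (T ⊆? S) ×-dec (independent? M T ×-dec (∣ T ∣ ≟ⁿ k)))

  emptyIndependent : IndependentOfSize 0
  emptyIndependent = ⊥ , (λ j∈⊥ → contradiction j∈⊥ ∉⊥) , (λ U U⊆⊥ (j , j∈U) _ → ∉⊥ (U⊆⊥ j∈U)) , ∣⊥∣≡0 m

  largestIndependent : ∀ k → (∀ k′ → IndependentOfSize k′ → k′ ≤ k) → ∃[ a ] IsRank M S a
  largestIndependent k bounded with independentOfSize? k
  ... | yes sizeK = k , sizeK , λ T T⊆S ind → bounded ∣ T ∣ (T , T⊆S , ind , refl)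
  largestIndependent zero    bounded | no noneOfSize0 = contradiction emptyIndependent noneOfSize0
  largestIndependent (suc k) bounded | no noneOfSizeK = largestIndependent k bounded′
    where
    bounded′ : ∀ k′ → IndependentOfSize k′ → k′ ≤ k
    bounded′ k′ sizeK′ with k′ ≟ⁿ suc k
    ... | yes refl = contradiction sizeK′ noneOfSizeK
    ... | no k′≢   = ≤-pred (≤∧≢⇒< (bounded k′ sizeK′) k′≢)

  rank-exists : ∃[ a ] IsRank M S a
  rank-exists = largestIndependent m (λ { k (T , _ , _ , refl) → ∣p∣≤n T })

rank<rows : ∀ {r m} {M : Matrix (suc r) m} {S : Subset m} {a} v →
  (∀ j → lookup S j ≡ true → M v j ≡ false) → IsRank M S a → a ≤ r
rank<rows {M = M} v vanish ((B , B⊆S , indB , refl) , _) =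
  independent-card≤rows (deleteRow v M) B
    (deleteRow-independent v (λ j Bj → vanish j (⊆-lookup B⊆S Bj)) indB)

-- the order k = r(S) + r(W-S) + 1 - r(M) is at most r(S) once r(W-S) < r(M)
separationOrder≤ : ∀ a {b c} → b < c → suc (a + b) ∸ c ≤ a
separationOrder≤ a {b} {c} b<c = m≤n+o⇒m∸n≤o (suc (a + b)) c
  (subst (_≤ c + a) (+-suc a b) (subst (a + suc b ≤_) (+-comm a c) (+-monoʳ-≤ a b<c)))

smallSides⇒verticalSep : ∀ {r m} {M : Matrix r m} {S : Subset m} {a b c} →
  IsRank M S a → IsRank M (∁ S) b → IsRank M ⊤ c → a < c → b < c →
  VerticalSep M (suc (a + b) ∸ c) S
smallSides⇒verticalSep {a = a} {b} {c} rS rW-S rM a<c b<c =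
  a , b , c , rS , rW-S , rM ,
  subst (suc (a + b) ≤_) (+-comm c (suc (a + b) ∸ c)) (m≤n+m∸n (suc (a + b)) c) ,
  separationOrder≤ a b<c ,
  subst (λ k → suc k ∸ c ≤ b) (+-comm b a) (separationOrder≤ b a<c)

kappa≤smallSide : ∀ {r m} {M : Matrix r m} {S : Subset m} {κ a b c} →
  IsKappa M κ → IsRank M S a → IsRank M (∁ S) b → IsRank M ⊤ c → a < c → b < c → κ ≤ a
kappa≤smallSide {S = S} {a = a} (_ , minimal) rS rW-S rM a<c b<c =
  ≤-trans (minimal _ (inj₁ (S , smallSides⇒verticalSep rS rW-S rM a<c b<c))) (separationOrder≤ a b<c)

δ-refl : ∀ {n} (a : Fin n) → δ a a ≡ true
δ-refl a = dec-true (a ≟ᶠ a) refl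

δ≡true⇒≡ : ∀ {n} {a b : Fin n} → δ a b ≡ true → a ≡ b
δ≡true⇒≡ {a = a} {b} δab with a ≟ᶠ b
... | yes a≡b = a≡b
δ≡true⇒≡ () | no _

identityColumns : ∀ n → Subset (n + (n + n))
identityColumns n = ⊤ {n} ++ ⊥ {n + n}

∣⊤++p∣ : ∀ k {l} (p : Subset l) → ∣ ⊤ {k} ++ p ∣ ≡ k + ∣ p ∣
∣⊤++p∣ zero    p = refl
∣⊤++p∣ (suc k) p = cong suc (∣⊤++p∣ k p)

∣identityColumns∣ : ∀ n → ∣ identityColumns n ∣ ≡ n
∣identityColumns∣ n = trans (∣⊤++p∣ n ⊥) (trans (cong (n +_) (∣⊥∣≡0 (n + n))) (+-identityʳ n))

identityColumn-block : ∀ n {j} → lookup (identityColumns n) j ≡ true → ∃[ a ] splitAt n j ≡ inj₁ a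
identityColumn-block n {j} j∈I = inFirstBlock (splitAt n j) refl
  (trans (≡-sym (lookup-splitAt n ⊤ ⊥ j)) j∈I)
  where
  inFirstBlock : ∀ s → splitAt n j ≡ s → [ lookup (⊤ {n}) , lookup (⊥ {n + n}) ]′ s ≡ true →
                 ∃[ a ] splitAt n j ≡ inj₁ a
  inFirstBlock (inj₁ a) split _   = a , split
  inFirstBlock (inj₂ b) _     b∈⊥ = contradiction (trans (≡-sym (lookup-replicate b false)) b∈⊥) λ ()

IAS-identityColumn : ∀ {n} (G : Graph n) i {j a} → splitAt n j ≡ inj₁ a → IAS G i j ≡ δ i a
IAS-identityColumn {n} G i {j} split with splitAt n j
IAS-identityColumn G i refl | inj₁ a = refl

-- in row a only the identity column e_a is nonzero among identity columns
identityColumns-independent : ∀ {n} (G : Graph n) → Independent (IAS G) (identityColumns n)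
identityColumns-independent {n} G U U⊆I (j , j∈U) sumsToZero =
  contradiction (trans (≡-sym rowA≡true) (sumsToZero a)) λ ()
  where
  Uj : lookup U j ≡ true
  Uj = []=⇒lookup j∈U
  a : Fin n
  a = proj₁ (identityColumn-block n (⊆-lookup U⊆I Uj))
  j-in-block-a : splitAt n j ≡ inj₁ a
  j-in-block-a = proj₂ (identityColumn-block n (⊆-lookup U⊆I Uj))
  only-j : ∀ j′ → lookup U j′ ≡ true → IAS G a j′ ≡ true → j′ ≡ j
  only-j j′ Uj′ IASaj′ with identityColumn-block n (⊆-lookup U⊆I Uj′)
  ... | a′ , j′-in-block-a′ = begin
    j′                               ≡⟨ ≡-sym (join-splitAt n (n + n) j′) ⟩
    join n (n + n) (splitAt n j′)    ≡⟨ cong (join n (n + n)) j′-in-block-a′ ⟩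
    join n (n + n) (inj₁ a′)         ≡⟨ cong (λ b → join n (n + n) (inj₁ b)) (≡-sym a≡a′) ⟩
    join n (n + n) (inj₁ a)          ≡⟨ cong (join n (n + n)) (≡-sym j-in-block-a) ⟩
    join n (n + n) (splitAt n j)     ≡⟨ join-splitAt n (n + n) j ⟩
    j                                ∎
    where
    open ≡-Reasoning
    a≡a′ : a ≡ a′
    a≡a′ = δ≡true⇒≡ (trans (≡-sym (IAS-identityColumn G a j′-in-block-a′)) IASaj′)
  rowA≡true : colSum (IAS G) U a ≡ true
  rowA≡true = colSum-uniqueSupport {M = IAS G} {U} {a} Uj (trans (IAS-identityColumn G a j-in-block-a) (δ-refl a)) only-j

rank-IAS≥ : ∀ {n} (G : Graph n) {c} → IsRank (IAS G) ⊤ c → n ≤ c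
rank-IAS≥ {n} G (_ , maximal) =
  subst (_≤ _) (∣identityColumns∣ n) (maximal (identityColumns n) ⊆⊤ (identityColumns-independent G))

columnVertex : ∀ n → Fin (n + (n + n)) → Fin n
columnVertex n j with splitAt n j
... | inj₁ a = a
... | inj₂ rest with splitAt n rest
...   | inj₁ b = b
...   | inj₂ c = c

IAS-support : ∀ {n} (G : Graph n) i j →
  adj G i (columnVertex n j) ≡ false → δ i (columnVertex n j) ≡ false → IAS G i j ≡ false
IAS-support {n} G i j notAdj notEq with splitAt n j
... | inj₁ a = notEq
... | inj₂ rest with splitAt n rest
...   | inj₁ b = notAdj
...   | inj₂ c = cong₂ _xor_ notAdj notEq

inClosedNbhd : ∀ {n} → Graph n → Fin n → Fin n → Bool
inClosedNbhd G u w = adj G u w ∨ δ u w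

nbhdColumns : ∀ {n} → Graph n → Fin n → Subset (n + (n + n))
nbhdColumns {n} G u = tabulate (λ j → inClosedNbhd G u (columnVertex n j))

FarApart : ∀ {n} → Graph n → Fin n → Fin n → Set
FarApart G u v = (u ≢ v) × ¬ Edge G u v × ¬ (∃[ w ] (Edge G u w × Edge G w v))

edge? : ∀ {n} (G : Graph n) u v → Dec (Edge G u v)
edge? G u v = ¬? (u ≟ᶠ v) ×-dec (adj G u v ≟ᵇ true)

distance≤2-or-far : ∀ {n} (G : Graph n) u v → (∃[ ℓ ] (ℓ ≤ 2 × Walk G u v ℓ)) ⊎ FarApart G u v
distance≤2-or-far G u v with u ≟ᶠ v
... | yes refl = inj₁ (0 , z≤n , here)
... | no u≢v with edge? G u v
...   | yes uv = inj₁ (1 , s≤s z≤n , step uv here)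
...   | no ¬uv with any? (λ w → edge? G u w ×-dec edge? G w v)
...     | yes (w , uw , wv) = inj₁ (2 , s≤s (s≤s z≤n) , step uw (step wv here))
...     | no ¬uwv           = inj₂ (u≢v , ¬uv , ¬uwv)

far⇒outsideNbhd : ∀ {n} {G : Graph n} {u v w} → FarApart G u v →
  inClosedNbhd G u w ≡ true → adj G v w ≡ false × δ v w ≡ false
far⇒outsideNbhd {G = G} {u} {v} {w} (u≢v , ¬uv , ¬uwv) w∈N with u ≟ᶠ w
... | yes refl =
  ¬-not (λ vu → ¬uv (u≢v , trans (Graph.sym G u v) vu)) , dec-false (v ≟ᶠ u) (λ v≡u → u≢v (≡-sym v≡u))
... | no u≢w =
  ¬-not (λ vw → ¬uwv (w , (u≢w , uw) , (w≢v , trans (Graph.sym G w v) vw))) , dec-false (v ≟ᶠ w) (λ v≡w → w≢v (≡-sym v≡w))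
  where
  uw : adj G u w ≡ true
  uw = trans (≡-sym (∨-identityʳ (adj G u w))) w∈N
  w≢v : w ≢ v
  w≢v refl = ¬uv (u≢w , uw)

nbhdColumns-vanish : ∀ {n} {G : Graph n} {u v} → FarApart G u v →
  ∀ j → lookup (nbhdColumns G u) j ≡ true → IAS G v j ≡ false
nbhdColumns-vanish {n} {G} {u} {v} far j j∈S =
  IAS-support G v j (proj₁ outside) (proj₂ outside)
  where
  outside : adj G v (columnVertex n j) ≡ false × δ v (columnVertex n j) ≡ false
  outside = far⇒outsideNbhd {G = G} far (trans (≡-sym (lookup∘tabulate _ j)) j∈S)

otherColumns-vanish : ∀ {n} (G : Graph n) u →
  ∀ j → lookup (∁ (nbhdColumns G u)) j ≡ true → IAS G u j ≡ false
otherColumns-vanish {n} G u j j∉S =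
  IAS-support G u j (∨-conicalˡ _ _ notInN) (∨-conicalʳ _ _ notInN)
  where
  notInN : inClosedNbhd G u (columnVertex n j) ≡ false
  notInN = not-injective (begin
    not (inClosedNbhd G u (columnVertex n j)) ≡⟨ cong not (≡-sym (lookup∘tabulate _ j)) ⟩
    not (lookup (nbhdColumns G u) j)          ≡⟨ ≡-sym (lookup-map j not (nbhdColumns G u)) ⟩
    lookup (∁ (nbhdColumns G u)) j            ≡⟨ j∉S ⟩
    true                                      ∎)
    where open ≡-Reasoning

far⇒kappa<n : ∀ {n} (G : Graph (suc n)) {u v κ} → FarApart G u v → IsKappa (IAS G) κ → κ ≤ n
far⇒kappa<n {n} G {u} {v} far κ-is
  with rank-exists (IAS G) (nbhdColumns G u) | rank-exists (IAS G) (∁ (nbhdColumns G u))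
     | rank-exists (IAS G) ⊤
... | a , rS | b , rW-S | c , rM =
  ≤-trans (kappa≤smallSide {M = IAS G} κ-is rS rW-S rM (<-≤-trans (s≤s a≤n) n<c) (<-≤-trans (s≤s b≤n) n<c)) a≤n
  where
  a≤n : a ≤ n
  a≤n = rank<rows {M = IAS G} v (nbhdColumns-vanish far) rS
  b≤n : b ≤ n
  b≤n = rank<rows {M = IAS G} u (otherColumns-vanish G u) rW-S
  n<c : suc n ≤ c
  n<c = rank-IAS≥ G rM

corollary31 : (n : ℕ) (G : Graph n) → IsKappa (IAS G) n → DiameterAtMost G 2
corollary31 zero    G κ≡n ()
corollary31 (suc n) G κ≡n u v with distance≤2-or-far G u v
... | inj₁ close = close
... | inj₂ far   = contradiction (far⇒kappa<n G far κ≡n) 1+n≰n
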